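{- Let $k\ge1$ and $0\le t\le k$ be integers and let $n\ge 1$. The total number of down-steps after the last up-step, summed over all $k_t$-Dyck paths of length $(k+1)n$, equals \[ s_{n,t,n}=\frac{t+1}{n+1}\binom{(k+1)(n+1)+t}{n}-\frac{(t+1)^2}{n}\binom{(k+1)n+t}{n-1}. \]
   Context: A $k_t$-Dyck path is a lattice path consisting of up-steps $(1,k)$ and down-steps $(1,-1)$ that starts at $(0,0)$, stays weakly above the line $y=-t$, and ends on the line $y=0$; with $n$ up-steps it has length $(k+1)n$. $s_{n,t,n}$ denotes the total number, over all $k_t$-Dyck paths with $n$ up-steps, of down-steps after the last up-step. -}

module Defs where

open import Data.Nat using (ℕ; zero; suc; _+_; _*_; _≤_; _≤?_)
open import Data.Bool using (Bool; true; false; _∧_)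
open import Data.List using (List; []; _∷_; map; _++_; filterᵇ)
open import Data.Nat.ListAction using (sum)
open import Relation.Nullary.Decidable using (does)

-- A step of a k_t-Dyck path: up-step (1,k) or down-step (1,-1).
data Step : Set where
  U D : Step

allSeqs : ℕ → List (List Step)
allSeqs zero    = [] ∷ []
allSeqs (suc m) = map (U ∷_) (allSeqs m) ++ map (D ∷_) (allSeqs m)

ups : List Step → ℕ
ups []       = 0
ups (U ∷ p)  = suc (ups p)
ups (D ∷ p)  = ups p

-- We track the height shifted by t so that heights are natural numbers.
validFrom : ℕ → ℕ → ℕ → List Step → Bool
validFrom k t h []        = does (h Data.Nat.≟ t)
validFrom k t h (U ∷ p)   = validFrom k t (h + k) p
validFrom k t zero (D ∷ p)    = false
validFrom k t (suc h) (D ∷ p) = validFrom k t h p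

-- p is a k_t-Dyck path: starts at (0,0), stays weakly above y = -t, ends on y = 0.
-- In shifted heights (y + t): start at t, stay ≥ 0, end at t.
isDyck : ℕ → ℕ → List Step → Bool
isDyck k t p = validFrom k t t p

dyckPaths : ℕ → ℕ → ℕ → List (List Step)
dyckPaths k t n = filterᵇ (λ p → isDyck k t p ∧ does (ups p Data.Nat.≟ n))
                         (allSeqs ((k + 1) * n))

trailingDowns : List Step → ℕ
trailingDowns []      = 0
trailingDowns (U ∷ p) = trailingDowns p
trailingDowns (D ∷ p) with ups p
... | zero  = suc (trailingDowns p)
... | suc _ = trailingDowns p

s : ℕ → ℕ → ℕ → ℕ
s k t n = sum (map trailingDowns (dyckPaths k t n))

module Submission where

-- For a start
-- height h, a length L and a number u of up-steps, 'paths h L u' counts the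
-- valid paths from h to t and 'trailing h L u' their total number of trailing
-- down-steps; both are defined by first-step recursions, shown to agree with
-- the list sums of Defs.  For t ≤ k, induction along these recursions gives
--  * the ballot formula (u+1)·paths h L (u+1) = (h+1)·C(h+(k+1)(u+1), u),
--    via its additive form C(P,u+1) − k·C(P,u), Pascal's rule and absorption;
--  * the trailing-descent identity
--    trailing h L u + (t+1)·paths h L u = paths h (L+k+1) (u+1).
-- At h = t, with D_n the number of k_t-Dyck paths, they give
-- n·D_n = (t+1)·C((k+1)n+t, n−1) and s_{n,t,n} = D_{n+1} − (t+1)·D_n;
-- clearing denominators yields the statement.  (The hypothesis 1 ≤ k is unused.)

open import Defs
open import Data.Nat using (ℕ; suc; _+_; _*_; _≤_; _^_)
open import Data.Nat.Combinatorics using (_C_)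
open import Relation.Binary.PropositionalEquality using (_≡_)

open import Data.Nat using (zero; _<_; s≤s; _≟_)
open import Data.Nat.Properties
open import Data.Nat.Combinatorics using (nCk+nC[k+1]≡[n+1]C[k+1]; nC1≡n)
open import Data.Nat.Tactic.RingSolver using (solve-∀)
open import Data.Bool using (Bool; true; false; _∧_; if_then_else_)
open import Data.Bool.Properties using (∧-zeroʳ)
open import Data.List using (List; []; _∷_; map; _++_; filterᵇ)
open import Data.List.Properties using (map-++; map-cong; map-∘)
open import Data.Nat.ListAction using (sum)
open import Data.Nat.ListAction.Properties using (sum-++)
open import Data.Empty using (⊥-elim)
open import Relation.Nullary using (does; yes; no)
open import Relation.Nullary.Decidable using (dec-true; dec-false)
open import Relation.Binary.PropositionalEquality
  using (_≢_; refl; sym; trans; cong; cong₂; subst; module ≡-Reasoning)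
open import Function using (_∘_)

pascal : ∀ n k → suc n C suc k ≡ n C k + n C suc k
pascal n k = sym (nCk+nC[k+1]≡[n+1]C[k+1] n k)


-- Absorption identity  (k+1)·C(n,k+1) = (n−k)·C(n,k), with the subtraction
-- moved to the right.  It turns the additive ballot formula below into the
-- multiplicative one.
absorption : ∀ n k → suc k * (n C suc k) + k * (n C k) ≡ n * (n C k)
absorption zero    zero    = refl
absorption zero    (suc k) rewrite *-zeroʳ k = refl
absorption (suc n) zero    =
  trans (+-identityʳ _) (trans (*-identityˡ _) (trans (nC1≡n (suc n)) (sym (*-identityʳ (suc n)))))
absorption (suc n) (suc j) = begin
    suc (suc j) * (suc n C suc (suc j)) + suc j * (suc n C suc j)
  ≡⟨ cong₂ (λ x y → suc (suc j) * x + suc j * y) (pascal n (suc j)) (pascal n j) ⟩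
    suc (suc j) * (b + c) + suc j * (a + b)
  ≡⟨ regroup j a b c ⟩
    (a + b) + ((suc j * b + j * a) + (suc (suc j) * c + suc j * b))
  ≡⟨ cong₂ (λ x y → (a + b) + (x + y)) (absorption n j) (absorption n (suc j)) ⟩
    (a + b) + (n * a + n * b)
  ≡⟨ distribute n a b ⟩
    suc n * (a + b)
  ≡⟨ cong (suc n *_) (sym (pascal n j)) ⟩
    suc n * (suc n C suc j)
  ∎
  where
    open ≡-Reasoning
    a = n C j
    b = n C suc j
    c = n C suc (suc j)
    regroup : ∀ j a b c → suc (suc j) * (b + c) + suc j * (a + b)
              ≡ (a + b) + ((suc j * b + j * a) + (suc (suc j) * c + suc j * b))
    regroup = solve-∀
    distribute : ∀ n a b → (a + b) + (n * a + n * b) ≡ suc n * (a + b)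
    distribute = solve-∀

-- The additive ballot quantity "from height −1" vanishes:
-- C(P, v+2) = k·C(P, v+1) for P = (k+1)(v+2) − 1.  This is what the first-step
-- recursion needs at height 0, where a first down-step would leave the strip.
ballot-boundary : ∀ k v → let P = k + (k + 1) * suc v in
  k * (P C suc v) ≡ P C suc (suc v)
ballot-boundary k v =
  sym (*-cancelˡ-≡ c′ (k * c) (suc (suc v))
        (+-cancelʳ-≡ (suc v * c) _ _ (trans (absorption P (suc v)) (split-length k v c))))
  where
    P  = k + (k + 1) * suc v
    c  = P C suc v
    c′ = P C suc (suc v)
    split-length : ∀ k v c → (k + (k + 1) * suc v) * c ≡ suc (suc v) * (k * c) + suc v * c
    split-length = solve-∀

-- If N₁ = C(Q,v+1) − k·C(Q,v) and N₂ = C(Q,v+2) − k·C(Q,v+1), then by Pascal's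
-- rule N₁ + N₂ = C(Q+1,v+2) − k·C(Q+1,v+1): the reflection formula below is
-- compatible with the first-step recursion of path counts.
pascal-step : ∀ k Q v N₁ N₂ →
  N₁ + k * (Q C v) ≡ Q C suc v → N₂ + k * (Q C suc v) ≡ Q C suc (suc v) →
  (N₁ + N₂) + k * (suc Q C suc v) ≡ suc Q C suc (suc v)
pascal-step k Q v N₁ N₂ e₁ e₂ = begin
    (N₁ + N₂) + k * (suc Q C suc v)
  ≡⟨ cong (λ x → (N₁ + N₂) + k * x) (pascal Q v) ⟩
    (N₁ + N₂) + k * (Q C v + Q C suc v)
  ≡⟨ interchange k N₁ N₂ (Q C v) (Q C suc v) ⟩
    (N₁ + k * (Q C v)) + (N₂ + k * (Q C suc v))
  ≡⟨ cong₂ _+_ e₁ e₂ ⟩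
    Q C suc v + Q C suc (suc v)
  ≡⟨ sym (pascal Q (suc v)) ⟩
    suc Q C suc (suc v)
  ∎
  where
    open ≡-Reasoning
    interchange : ∀ k a b x y → (a + b) + k * (x + y) ≡ (a + k * x) + (b + k * y)
    interchange = solve-∀

total : ℕ → (List Step → ℕ) → ℕ
total L f = sum (map f (allSeqs L))

total-suc : ∀ L f → total (suc L) f ≡ total L (f ∘ (U ∷_)) + total L (f ∘ (D ∷_))
total-suc L f = begin
    sum (map f (map (U ∷_) ps ++ map (D ∷_) ps))
  ≡⟨ cong sum (map-++ f (map (U ∷_) ps) (map (D ∷_) ps)) ⟩
    sum (map f (map (U ∷_) ps) ++ map f (map (D ∷_) ps))
  ≡⟨ sum-++ (map f (map (U ∷_) ps)) _ ⟩
    sum (map f (map (U ∷_) ps)) + sum (map f (map (D ∷_) ps))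
  ≡⟨ cong₂ _+_ (cong sum (sym (map-∘ ps))) (cong sum (sym (map-∘ ps))) ⟩
    total L (f ∘ (U ∷_)) + total L (f ∘ (D ∷_))
  ∎
  where
    open ≡-Reasoning
    ps = allSeqs L

sum-map-zero : ∀ {A : Set} {f : A → ℕ} (xs : List A) → (∀ x → f x ≡ 0) → sum (map f xs) ≡ 0
sum-map-zero []       f≡0 = refl
sum-map-zero (x ∷ xs) f≡0 = cong₂ _+_ (f≡0 x) (sum-map-zero xs f≡0)

sum-map-+ : ∀ {A : Set} (f g : A → ℕ) (xs : List A) →
  sum (map (λ x → f x + g x) xs) ≡ sum (map f xs) + sum (map g xs)
sum-map-+ f g []       = refl
sum-map-+ f g (x ∷ xs) = trans (cong (f x + g x +_) (sum-map-+ f g xs)) (interchange (f x) (g x) _ _)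
  where
    interchange : ∀ a b c d → a + b + (c + d) ≡ a + c + (b + d)
    interchange = solve-∀

sum-filter : ∀ {A : Set} (P : A → Bool) (g : A → ℕ) (xs : List A) →
  sum (map g (filterᵇ P xs)) ≡ sum (map (λ x → if P x then g x else 0) xs)
sum-filter P g []       = refl
sum-filter P g (x ∷ xs) with P x
... | true  = cong (g x +_) (sum-filter P g xs)
... | false = sum-filter P g xs

if-∧-false : ∀ (b : Bool) {x : ℕ} → (if b ∧ false then x else 0) ≡ 0
if-∧-false b = cong (λ c → if c then _ else 0) (∧-zeroʳ b)

if-zero : ∀ (b : Bool) → (if b then 0 else 0) ≡ 0
if-zero true  = refl
if-zero false = refl

module Paths (k t : ℕ) where

  restrict : ℕ → ℕ → (List Step → ℕ) → List Step → ℕ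
  restrict h u f p = if validFrom k t h p ∧ does (ups p ≟ u) then f p else 0

  paths : ℕ → ℕ → ℕ → ℕ
  paths h       zero    u       = restrict h u (λ _ → 1) []
  paths zero    (suc L) zero    = 0
  paths (suc h) (suc L) zero    = paths h L zero
  paths zero    (suc L) (suc u) = paths k L u
  paths (suc h) (suc L) (suc u) = paths (suc h + k) L u + paths h L (suc u)

  -- trailing h L u: the total number of down-steps after the last up-step over
  -- these paths.  A first down-step is trailing exactly when no up-step follows.
  trailing : ℕ → ℕ → ℕ → ℕ
  trailing h       zero    u       = 0
  trailing zero    (suc L) zero    = 0
  trailing (suc h) (suc L) zero    = trailing h L zero + paths h L zero
  trailing zero    (suc L) (suc u) = trailing k L u
  trailing (suc h) (suc L) (suc u) = trailing (suc h + k) L u + trailing h L (suc u)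

  total-D-at-0 : ∀ L u f → total L (restrict 0 u f ∘ (D ∷_)) ≡ 0
  total-D-at-0 L u f = sum-map-zero (allSeqs L) (λ _ → refl)

  total-U-none : ∀ L h f → total L (restrict h 0 f ∘ (U ∷_)) ≡ 0
  total-U-none L h f = sum-map-zero (allSeqs L) (λ q → if-∧-false (validFrom k t (h + k) q))

  paths-total : ∀ L h u → total L (restrict h u (λ _ → 1)) ≡ paths h L u
  paths-total zero    h       u       = +-identityʳ _
  paths-total (suc L) zero    zero    =
    trans (total-suc L _) (cong₂ _+_ (total-U-none L 0 (λ _ → 1)) (total-D-at-0 L 0 (λ _ → 1)))
  paths-total (suc L) (suc h) zero    =
    trans (total-suc L _) (cong₂ _+_ (total-U-none L (suc h) (λ _ → 1)) (paths-total L h zero))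
  paths-total (suc L) zero    (suc u) =
    trans (total-suc L _)
      (trans (cong₂ _+_ (paths-total L k u) (total-D-at-0 L (suc u) (λ _ → 1))) (+-identityʳ _))
  paths-total (suc L) (suc h) (suc u) =
    trans (total-suc L _) (cong₂ _+_ (paths-total L (suc h + k) u) (paths-total L h (suc u)))

  restrict-D-last : ∀ h q → restrict (suc h) 0 trailingDowns (D ∷ q)
                          ≡ restrict h 0 trailingDowns q + restrict h 0 (λ _ → 1) q
  restrict-D-last h q with validFrom k t h q | ups q
  ... | true  | zero  = +-comm 1 _
  ... | true  | suc _ = refl
  ... | false | zero  = refl
  ... | false | suc _ = refl

  restrict-D-inner : ∀ h u q → restrict (suc h) (suc u) trailingDowns (D ∷ q)
                             ≡ restrict h (suc u) trailingDowns q
  restrict-D-inner h u q with validFrom k t h q | ups q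
  ... | true  | zero  = refl
  ... | true  | suc _ = refl
  ... | false | zero  = refl
  ... | false | suc _ = refl

  trailing-total : ∀ L h u → total L (restrict h u trailingDowns) ≡ trailing h L u
  trailing-total zero    h       u       = trans (+-identityʳ _) (if-zero _)
  trailing-total (suc L) zero    zero    =
    trans (total-suc L _) (cong₂ _+_ (total-U-none L 0 trailingDowns) (total-D-at-0 L 0 trailingDowns))
  trailing-total (suc L) (suc h) zero    =
    trans (total-suc L _) (cong₂ _+_ (total-U-none L (suc h) trailingDowns) (begin
        total L (restrict (suc h) 0 trailingDowns ∘ (D ∷_))
      ≡⟨ cong sum (map-cong (restrict-D-last h) (allSeqs L)) ⟩
        sum (map (λ q → restrict h 0 trailingDowns q + restrict h 0 (λ _ → 1) q) (allSeqs L))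
      ≡⟨ sum-map-+ (restrict h 0 trailingDowns) _ (allSeqs L) ⟩
        total L (restrict h 0 trailingDowns) + total L (restrict h 0 (λ _ → 1))
      ≡⟨ cong₂ _+_ (trailing-total L h zero) (paths-total L h zero) ⟩
        trailing h L zero + paths h L zero
      ∎))
    where open ≡-Reasoning
  trailing-total (suc L) zero    (suc u) =
    trans (total-suc L _)
      (trans (cong₂ _+_ (trailing-total L k u) (total-D-at-0 L (suc u) trailingDowns)) (+-identityʳ _))
  trailing-total (suc L) (suc h) (suc u) =
    trans (total-suc L _)
      (cong₂ _+_ (trailing-total L (suc h + k) u)
                 (trans (cong sum (map-cong (restrict-D-inner h u) (allSeqs L))) (trailing-total L h (suc u))))

  s≡trailing : ∀ n → s k t n ≡ trailing t ((k + 1) * n) n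
  s≡trailing n =
    trans (sum-filter (λ p → isDyck k t p ∧ does (ups p ≟ n)) trailingDowns (allSeqs ((k + 1) * n)))
          (trailing-total ((k + 1) * n) t n)

  paths-empty-invalid : ∀ h → h ≢ t → paths h 0 0 ≡ 0
  paths-empty-invalid h h≢t = cong (λ b → if b ∧ true then 1 else 0) (dec-false (h ≟ t) h≢t)

  paths-outside : ∀ h L u → L + t ≢ h + (k + 1) * u → paths h L u ≡ 0
  paths-outside h       zero    zero    ≠ = paths-empty-invalid h (λ h≡t → ≠ (trans (sym h≡t) (sym no-up)))
    where
      no-up : h + (k + 1) * 0 ≡ h
      no-up = trans (cong (h +_) (*-zeroʳ (k + 1))) (+-identityʳ h)
  paths-outside h       zero    (suc u) ≠ = if-∧-false (does (h ≟ t))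
  paths-outside zero    (suc L) zero    ≠ = refl
  paths-outside (suc h) (suc L) zero    ≠ = paths-outside h L zero (≠ ∘ cong suc)
  paths-outside zero    (suc L) (suc u) ≠ =
    paths-outside k L u (λ e → ≠ (trans (cong suc e) (up-length k u)))
    where
      up-length : ∀ k u → suc (k + (k + 1) * u) ≡ 0 + (k + 1) * suc u
      up-length = solve-∀
  paths-outside (suc h) (suc L) (suc u) ≠ =
    cong₂ _+_ (paths-outside (suc h + k) L u (λ e → ≠ (trans (cong suc e) (up-length h k u))))
              (paths-outside h L (suc u) (≠ ∘ cong suc))
    where
      up-length : ∀ h k u → suc (suc h + k + (k + 1) * u) ≡ suc h + (k + 1) * suc u
      up-length = solve-∀

  paths-flat : ∀ h L → L + t ≡ h → paths h L 0 ≡ 1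
  paths-flat h       zero    t≡h = cong (λ b → if b ∧ true then 1 else 0) (dec-true (h ≟ t) (sym t≡h))
  paths-flat zero    (suc L) ()
  paths-flat (suc h) (suc L) e = paths-flat h L (suc-injective e)

  -- Both counts are the indicator of the same length condition.
  paths-flat-shift : ∀ h L j → paths h L 0 ≡ paths (h + j) (L + j) 0
  paths-flat-shift h L zero    rewrite +-identityʳ h | +-identityʳ L = refl
  paths-flat-shift h L (suc j) rewrite +-suc h j | +-suc L j = paths-flat-shift h L j

  -- The counting formulas need the strip to be no deeper than one up-step.
  module _ (t≤k : t ≤ k) where

    -- Since t ≤ k, a path with an up-step is never empty.
    below-up : ∀ h u → t < h + (k + 1) * suc u
    below-up h u = subst (t <_) (sym (expand h k u)) (s≤s (≤-trans t≤k (m≤m+n k _)))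
      where
        expand : ∀ h k u → h + (k + 1) * suc u ≡ suc (k + (h + (k + 1) * u))
        expand = solve-∀

    reflection : ∀ h L u → L + t ≡ h + (k + 1) * suc u →
      paths h L (suc u) + k * ((h + (k + 1) * suc u) C u) ≡ (h + (k + 1) * suc u) C suc u
    reflection h zero u e = ⊥-elim (<⇒≢ (below-up h u) e)
    reflection zero (suc L) zero e =
      trans (cong (_+ k * 1) (paths-flat k L (suc-injective (trans e (one-up k)))))
            (trans (cong suc (*-identityʳ k)) (sym (trans (nC1≡n _) (one-up k))))
      where
        one-up : ∀ k → 0 + (k + 1) * 1 ≡ suc k
        one-up = solve-∀
    reflection (suc h) (suc L) zero e =
      trans (cong (λ n → n + paths h L 1 + k * 1)
                  (paths-flat (suc h + k) L (suc-injective (trans e (one-up h k)))))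
            (trans (cong suc (reflection h L zero (suc-injective e)))
                   (trans (cong suc (nC1≡n _)) (sym (nC1≡n (suc h + (k + 1) * 1)))))
      where
        one-up : ∀ h k → suc h + (k + 1) * 1 ≡ suc (suc h + k)
        one-up = solve-∀
    reflection zero (suc L) (suc v) e =
      subst (λ P → N + k * (P C suc v) ≡ P C suc (suc v)) (one-more k v)
        (trans (cong (_+ k * (suc Q C suc v)) (sym (+-identityʳ N)))
               (pascal-step k Q v N 0
                 (reflection k L v (suc-injective (trans e (sym (one-more k v)))))
                 (ballot-boundary k v)))
      where
        Q = k + (k + 1) * suc v
        N = paths k L (suc v)
        one-more : ∀ k v → suc (k + (k + 1) * suc v) ≡ 0 + (k + 1) * suc (suc v)
        one-more = solve-∀
    reflection (suc h) (suc L) (suc v) e =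
      pascal-step k (h + (k + 1) * suc (suc v)) v _ _
        (subst (λ P → paths (suc h + k) L (suc v) + k * (P C v) ≡ P C suc v) (sym (regroup h k v))
               (reflection (suc h + k) L v (trans (suc-injective e) (regroup h k v))))
        (reflection h L (suc v) (suc-injective e))
      where
        regroup : ∀ h k v → h + (k + 1) * suc (suc v) ≡ suc h + k + (k + 1) * suc v
        regroup = solve-∀

    ballot : ∀ h L u → L + t ≡ h + (k + 1) * suc u → suc u * paths h L (suc u) ≡ suc h * ((L + t) C u)
    ballot h L u e rewrite e = +-cancelʳ-≡ ((suc u * k + u) * c) _ _ (begin
        suc u * N + (suc u * k + u) * c
      ≡⟨ regroup u k N c ⟩
        suc u * (N + k * c) + u * c
      ≡⟨ cong (λ x → suc u * x + u * c) (reflection h L u e) ⟩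
        suc u * (P C suc u) + u * c
      ≡⟨ absorption P u ⟩
        P * c
      ≡⟨ expand h k u c ⟩
        suc h * c + (suc u * k + u) * c
      ∎)
      where
        open ≡-Reasoning
        P = h + (k + 1) * suc u
        N = paths h L (suc u)
        c = P C u
        regroup : ∀ u k N c → suc u * N + (suc u * k + u) * c ≡ suc u * (N + k * c) + u * c
        regroup = solve-∀
        expand : ∀ h k u c → (h + (k + 1) * suc u) * c ≡ suc h * c + (suc u * k + u) * c
        expand = solve-∀

    -- The base case (L, u) = (0, 0) is the ballot formula for a single
    -- up-step; the rest follows the first-step recursion.
    trailing-identity : ∀ h L u → trailing h L u + (t + 1) * paths h L u ≡ paths h (L + suc k) (suc u)
    trailing-identity h zero zero with h ≟ t
    ... | yes refl = begin
        (t + 1) * paths t 0 0  ≡⟨ cong ((t + 1) *_) (paths-flat t 0 refl) ⟩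
        (t + 1) * 1            ≡⟨ cong (_* 1) (+-comm t 1) ⟩
        suc t * 1              ≡⟨ sym (ballot t (suc k) 0 (single-up k t)) ⟩
        1 * paths t (suc k) 1  ≡⟨ *-identityˡ _ ⟩
        paths t (suc k) 1      ∎
      where
        open ≡-Reasoning
        single-up : ∀ k t → suc k + t ≡ t + (k + 1) * 1
        single-up = solve-∀
    ... | no h≢t =
      trans (cong ((t + 1) *_) (paths-empty-invalid h h≢t))
            (trans (*-zeroʳ (t + 1)) (sym (paths-outside h (suc k) 1 (h≢t ∘ sym ∘ cancel))))
      where
        single-up : ∀ k h → h + (k + 1) * 1 ≡ suc k + h
        single-up = solve-∀
        cancel : suc k + t ≡ h + (k + 1) * 1 → t ≡ h
        cancel e = +-cancelˡ-≡ (suc k) t h (trans e (single-up k h))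
    trailing-identity zero (suc L) zero =
      trans (*-zeroʳ (t + 1))
            (sym (paths-outside k (L + suc k) 0 (λ e → m≢1+m+n _ (trans (sym e) (too-long L k t)))))
      where
        too-long : ∀ L k t → L + suc k + t ≡ suc ((k + (k + 1) * 0) + (L + t))
        too-long = solve-∀
    trailing-identity (suc h) (suc L) zero = begin
        (W + N) + (t + 1) * N
      ≡⟨ regroup W N (t + 1) ⟩
        N + (W + (t + 1) * N)
      ≡⟨ cong₂ _+_ shifted (trailing-identity h L zero) ⟩
        paths (suc h + k) (L + suc k) 0 + paths h (L + suc k) 1
      ∎
      where
        open ≡-Reasoning
        W = trailing h L zero
        N = paths h L zero
        shifted : N ≡ paths (suc h + k) (L + suc k) 0
        shifted = trans (paths-flat-shift h L (suc k)) (cong (λ x → paths x (L + suc k) 0) (+-suc h k))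
        regroup : ∀ W N c → (W + N) + c * N ≡ N + (W + c * N)
        regroup = solve-∀
    trailing-identity h zero (suc u) =
      trans (cong ((t + 1) *_) (if-∧-false (does (h ≟ t))))
            (trans (*-zeroʳ (t + 1)) (sym (paths-outside h (suc k) (suc (suc u)) (<⇒≢ too-short))))
      where
        one-more : ∀ h k u → suc k + (h + (k + 1) * suc u) ≡ h + (k + 1) * suc (suc u)
        one-more = solve-∀
        too-short : suc k + t < h + (k + 1) * suc (suc u)
        too-short = subst (suc k + t <_) (one-more h k u) (+-monoʳ-< (suc k) (below-up h u))
    trailing-identity zero (suc L) (suc u) = trailing-identity k L u
    trailing-identity (suc h) (suc L) (suc u) =
      trans (interchange (trailing (suc h + k) L u) (trailing h L (suc u))
                         (paths (suc h + k) L u) (paths h L (suc u)) (t + 1))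
            (cong₂ _+_ (trailing-identity (suc h + k) L u) (trailing-identity h L (suc u)))
      where
        interchange : ∀ a b x y c → (a + b) + c * (x + y) ≡ (a + c * x) + (b + c * y)
        interchange = solve-∀

    s-recurrence : ∀ n → s k t n + (t + 1) * paths t ((k + 1) * n) n ≡ paths t ((k + 1) * suc n) (suc n)
    s-recurrence n = begin
        s k t n + (t + 1) * paths t ((k + 1) * n) n
      ≡⟨ cong (_+ (t + 1) * paths t ((k + 1) * n) n) (s≡trailing n) ⟩
        trailing t ((k + 1) * n) n + (t + 1) * paths t ((k + 1) * n) n
      ≡⟨ trailing-identity t ((k + 1) * n) n ⟩
        paths t ((k + 1) * n + suc k) (suc n)
      ≡⟨ cong (λ L → paths t L (suc n)) (one-more k n) ⟩
        paths t ((k + 1) * suc n) (suc n)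
      ∎
      where
        open ≡-Reasoning
        one-more : ∀ k n → (k + 1) * n + suc k ≡ (k + 1) * suc n
        one-more = solve-∀

    dyck-count : ∀ m → suc m * paths t ((k + 1) * suc m) (suc m) ≡ (t + 1) * (((k + 1) * suc m + t) C m)
    dyck-count m = trans (ballot t ((k + 1) * suc m) m (+-comm _ t))
                         (cong (_* (((k + 1) * suc m + t) C m)) (+-comm 1 t))

clear-denominators : ∀ {n t x N N′ c c′} → x + (t + 1) * N ≡ N′ → n * N ≡ (t + 1) * c →
  suc n * N′ ≡ (t + 1) * c′ → n * suc n * x + suc n * (t + 1) ^ 2 * c ≡ n * (t + 1) * c′
clear-denominators {n} {t} {x} {N} {N′} {c} {c′} recurrence count count′ = begin
    n * suc n * x + suc n * (t + 1) ^ 2 * c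
  ≡⟨ factor n t x c ⟩
    suc n * (n * x + (t + 1) * ((t + 1) * c))
  ≡⟨ cong (λ z → suc n * (n * x + (t + 1) * z)) (sym count) ⟩
    suc n * (n * x + (t + 1) * (n * N))
  ≡⟨ refactor n t x N ⟩
    n * (suc n * (x + (t + 1) * N))
  ≡⟨ cong (λ z → n * (suc n * z)) recurrence ⟩
    n * (suc n * N′)
  ≡⟨ cong (n *_) count′ ⟩
    n * ((t + 1) * c′)
  ≡⟨ sym (*-assoc n (t + 1) c′) ⟩
    n * (t + 1) * c′
  ∎
  where
    open ≡-Reasoning
    -- (t + 1) ^ 2 unfolds to (t + 1) * ((t + 1) * 1)
    factor : ∀ n t x c → n * suc n * x + suc n * ((t + 1) * ((t + 1) * 1)) * c
                         ≡ suc n * (n * x + (t + 1) * ((t + 1) * c))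
    factor = solve-∀
    refactor : ∀ n t x N → suc n * (n * x + (t + 1) * (n * N)) ≡ n * (suc n * (x + (t + 1) * N))
    refactor = solve-∀

proposition5p2 : (k t m : ℕ) → 1 ≤ k → t ≤ k →
    let n = suc m in
    n * (n + 1) * s k t n + (n + 1) * (t + 1) ^ 2 * (((k + 1) * n + t) C m)
      ≡ n * (t + 1) * (((k + 1) * (n + 1) + t) C n)
-- With n = m + 1 (and n + 1 normalised to suc n), combine the recurrence for
-- s_{n,t,n} with the Dyck-path counts for n and n + 1.
proposition5p2 k t m _ t≤k rewrite +-comm m 1 =
  clear-denominators {suc m} {t}
    (s-recurrence t≤k (suc m)) (dyck-count t≤k m) (dyck-count t≤k (suc m))
  where open Paths k t using (s-recurrence; dyck-count)
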